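{- Let $A=\{a_1,\dots,a_{|A|}\}$, $B=\{b_1,\dots,b_{|B|}\}$, $H=\{h_1,\dots,h_{|H|}\}$, $K=\{k_1,\dots,k_{|K|}\}$ be finite sets of nodes with $A\cap B=\emptyset$ and $H\cap K=\emptyset$, and put $U=A\cup B$, $V=H\cup K$, where $U$ and $V$ are disjoint and nonempty. Let $\mathcal{P}=(p_1,\dots,p_{|A|})$ and $\mathcal{Q}=(q_1,\dots,q_{|H|})$ be sequences of integers and $\varepsilon$ a non-negative integer. Then the triplet $(\mathcal{P},\mathcal{Q},\varepsilon)$ is graphical if and only if it admits a balanced realization.
   Context: A realization of the triplet $(\mathcal{P},\mathcal{Q},\varepsilon)$ is a simple bipartite graph with parts $U$ and $V$ (all edges join a node of $U$ to a node of $V$), having exactly $\varepsilon$ edges, in which $a_i$ has degree $p_i$ for every $i\le |A|$ and $h_i$ has degree $q_i$ for every $i\le |H|$. The triplet is graphical if it has at least one realization. Let $P=\sum_i p_i$, $Q=\sum_i q_i$, $\mu=(\varepsilon-P)/|B|$ and $\nu=(\varepsilon-Q)/|K|$. A realization is balanced if every node of $B$ has degree $\lfloor\mu\rfloor$ or $\lceil\mu\rceil$ and every node of $K$ has degree $\lfloor\nu\rfloor$ or $\lceil\nu\rceil$ (the condition on $B$, resp. $K$, being vacuous if that set is empty); equivalently $\sum_{b\in B}\lfloor |d_b-\mu|\rfloor=0$ and $\sum_{k\in K}\lfloor|d_k-\nu|\rfloor=0$, where $d_x$ denotes the degree of node $x$. -}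

module Defs where

open import Data.Nat using (ℕ; zero; suc; _+_; _≥_)
open import Data.Integer as ℤ using (ℤ; +_)
open import Data.Rational using (ℚ; floor; ceiling; _/_)
open import Data.Fin using (Fin; zero; suc)
open import Data.Bool using (Bool; true; false)
open import Data.Sum using (_⊎_; inj₁; inj₂)
open import Data.Product using (_×_; ∃)
open import Data.Unit using (⊤)
open import Relation.Binary.PropositionalEquality using (_≡_)

∑ : (n : ℕ) → (Fin n → ℕ) → ℕ
∑ zero    f = 0
∑ (suc n) f = f zero + ∑ n (λ i → f (suc i))

∑ℤ : (n : ℕ) → (Fin n → ℤ) → ℤ
∑ℤ zero    f = + 0
∑ℤ (suc n) f = f zero ℤ.+ ∑ℤ n (λ i → f (suc i))

b2n : Bool → ℕ
b2n true  = 1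
b2n false = 0

U : ℕ → ℕ → Set
U nA nB = Fin nA ⊎ Fin nB

V : ℕ → ℕ → Set
V nH nK = Fin nH ⊎ Fin nK

-- A simple bipartite graph between U and V is given by its adjacency
-- relation (each pair u,v is either an edge or not; no multi-edges).
BipGraph : ℕ → ℕ → ℕ → ℕ → Set
BipGraph nA nB nH nK = U nA nB → V nH nK → Bool

module _ {nA nB nH nK : ℕ} (G : BipGraph nA nB nH nK) where

  degU : U nA nB → ℕ
  degU u = ∑ nH (λ h → b2n (G u (inj₁ h))) + ∑ nK (λ k → b2n (G u (inj₂ k)))

  degV : V nH nK → ℕ
  degV v = ∑ nA (λ a → b2n (G (inj₁ a) v)) + ∑ nB (λ b → b2n (G (inj₂ b) v))

  edges : ℕ
  edges = ∑ nA (λ a → degU (inj₁ a)) + ∑ nB (λ b → degU (inj₂ b))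

IsRealization : {nA nB nH nK : ℕ} → (Fin nA → ℤ) → (Fin nH → ℤ) → ℕ →
                BipGraph nA nB nH nK → Set
IsRealization {nA} {nB} {nH} {nK} p q ε G =
  (edges G ≡ ε) ×
  ((i : Fin nA) → + degU G (inj₁ i) ≡ p i) ×
  ((i : Fin nH) → + degV G (inj₁ i) ≡ q i)

Graphical : (nA nB nH nK : ℕ) → (Fin nA → ℤ) → (Fin nH → ℤ) → ℕ → Set
Graphical nA nB nH nK p q ε = ∃ λ (G : BipGraph nA nB nH nK) → IsRealization p q ε G

NearlyEqual : (n : ℕ) → ℤ → (Fin n → ℕ) → Set
NearlyEqual zero    num d = ⊤
NearlyEqual (suc n) num d =
  (x : Fin (suc n)) → (+ d x ≡ floor (num / suc n)) ⊎ (+ d x ≡ ceiling (num / suc n))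

IsBalanced : {nA nB nH nK : ℕ} → (Fin nA → ℤ) → (Fin nH → ℤ) → ℕ →
             BipGraph nA nB nH nK → Set
IsBalanced {nA} {nB} {nH} {nK} p q ε G =
  NearlyEqual nB (+ ε ℤ.- ∑ℤ nA p) (λ b → degU G (inj₂ b)) ×
  NearlyEqual nK (+ ε ℤ.- ∑ℤ nH q) (λ k → degV G (inj₂ k))

HasBalancedRealization : (nA nB nH nK : ℕ) → (Fin nA → ℤ) → (Fin nH → ℤ) → ℕ → Set
HasBalancedRealization nA nB nH nK p q ε =
  ∃ λ (G : BipGraph nA nB nH nK) → IsRealization p q ε G × IsBalanced p q ε G

-- If two nodes b, b′ of B have degrees differing by at least two, then b has a neighbour v
-- that b′ lacks; replacing the edge bv by b′v changes no degree outside B and strictly lowers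
-- the sum of the squares of the B-degrees. Iterating from any realization therefore reaches
-- one whose B-degrees pairwise differ by at most one, and since they sum to ε − P each of them
-- is ⌊μ⌋ or ⌈μ⌉. The same moves in the transposed graph balance K while fixing every degree in U.

module Submission where

open import Defs
open import Data.Bool using (Bool; true; false; if_then_else_; _∧_)
open import Data.Fin using (Fin; zero; suc)
import Data.Fin.Properties as FinP
open import Data.Integer as ℤ using (ℤ; +_)
import Data.Integer.Properties as ℤP
open import Data.Integer.DivMod using ([n/ℕd]*d≤n; n<s[n/ℕd]*d)
open import Data.Nat as ℕ using (ℕ; zero; suc; _+_; _*_; _≤_; _<_; _≥_)
open import Data.Nat.GCD using (gcd; gcd[m,n]≢0)
open import Data.Nat.Induction using (<-wellFounded)
import Data.Nat.Properties as ℕP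
open import Data.Nat.Tactic.RingSolver using (solve-∀)
open import Data.Product using (Σ; ∃; ∃₂; _×_; _,_)
open import Data.Rational as ℚ using (ℚ; mkℚ; _/_; floor; ceiling; ↥_; ↧_)
open import Data.Rational.Properties using (↥-/; ↧-/; ↥-neg; ↧-neg)
open import Data.Sum using (_⊎_; inj₁; inj₂)
open import Data.Sum.Properties using (≡-dec; inj₁-injective; inj₂-injective)
open import Data.Vec.Functional using (updateAt)
open import Data.Vec.Functional.Properties using (updateAt-updates; updateAt-minimal)
open import Function using (_∘_)
open import Induction.WellFounded using (Acc; acc)
open import Relation.Binary.PropositionalEquality
open import Relation.Binary.Definitions using (DecidableEquality)
open import Relation.Nullary using (Dec; yes; no; does; contradiction)

open import Algebra.Properties.CommutativeSemigroup ℕP.+-commutativeSemigroup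
  using (interchange; x∙yz≈y∙xz; xy∙z≈y∙xz)

∑-cong : ∀ n {f g : Fin n → ℕ} → (∀ i → f i ≡ g i) → ∑ n f ≡ ∑ n g
∑-cong zero    f≗g = refl
∑-cong (suc n) f≗g = cong₂ _+_ (f≗g zero) (∑-cong n (f≗g ∘ suc))

∑-mono-≤ : ∀ n {f g : Fin n → ℕ} → (∀ i → f i ≤ g i) → ∑ n f ≤ ∑ n g
∑-mono-≤ zero    f≤g = ℕ.z≤n
∑-mono-≤ (suc n) f≤g = ℕP.+-mono-≤ (f≤g zero) (∑-mono-≤ n (f≤g ∘ suc))

∑-mono-< : ∀ n {f g : Fin n → ℕ} → (∀ i → f i ≤ g i) → ∀ j → f j < g j → ∑ n f < ∑ n g
∑-mono-< (suc n) f≤g zero    fj<gj = ℕP.+-mono-<-≤ fj<gj (∑-mono-≤ n (f≤g ∘ suc))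
∑-mono-< (suc n) f≤g (suc j) fj<gj = ℕP.+-mono-≤-< (f≤g zero) (∑-mono-< n (f≤g ∘ suc) j fj<gj)

∑-const : ∀ n c → ∑ n (λ _ → c) ≡ c * n
∑-const zero    c = sym (ℕP.*-zeroʳ c)
∑-const (suc n) c = trans (cong (_+_ c) (∑-const n c)) (sym (ℕP.*-suc c n))

∑-distrib-+ : ∀ n (f g : Fin n → ℕ) → ∑ n (λ i → f i + g i) ≡ ∑ n f + ∑ n g
∑-distrib-+ zero    f g = refl
∑-distrib-+ (suc n) f g = begin
  f zero + g zero + ∑ n (λ i → f (suc i) + g (suc i))
    ≡⟨ cong (_+_ (f zero + g zero)) (∑-distrib-+ n (f ∘ suc) (g ∘ suc)) ⟩
  f zero + g zero + (∑ n (f ∘ suc) + ∑ n (g ∘ suc))     ≡⟨ interchange (f zero) (g zero) _ _ ⟩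
  f zero + ∑ n (f ∘ suc) + (g zero + ∑ n (g ∘ suc))     ∎
  where open ≡-Reasoning

∑-comm : ∀ m n (f : Fin m → Fin n → ℕ) → ∑ m (λ i → ∑ n (f i)) ≡ ∑ n (λ j → ∑ m (λ i → f i j))
∑-comm zero    n f = sym (trans (∑-const n 0) (ℕP.*-zeroˡ n))
∑-comm (suc m) n f = trans (cong (_+_ (∑ n (f zero))) (∑-comm m n (f ∘ suc)))
                           (sym (∑-distrib-+ n (f zero) (λ j → ∑ m (λ i → f (suc i) j))))

∑-update : ∀ n (f g : Fin n → ℕ) i → (∀ j → j ≢ i → f j ≡ g j) → g i + ∑ n f ≡ f i + ∑ n g
∑-update (suc n) f g zero f≗g = begin
  g zero + (f zero + ∑ n (f ∘ suc))  ≡⟨ x∙yz≈y∙xz (g zero) (f zero) _ ⟩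
  f zero + (g zero + ∑ n (f ∘ suc))  ≡⟨ cong (λ s → f zero + (g zero + s)) (∑-cong n λ j → f≗g (suc j) λ ()) ⟩
  f zero + (g zero + ∑ n (g ∘ suc))  ∎
  where open ≡-Reasoning
∑-update (suc n) f g (suc i) f≗g = begin
  g (suc i) + (f zero + ∑ n (f ∘ suc))  ≡⟨ x∙yz≈y∙xz (g (suc i)) (f zero) _ ⟩
  f zero + (g (suc i) + ∑ n (f ∘ suc))  ≡⟨ cong₂ _+_ (f≗g zero λ ())
                                                    (∑-update n (f ∘ suc) (g ∘ suc) i λ j j≢i →
                                                       f≗g (suc j) (j≢i ∘ FinP.suc-injective)) ⟩
  g zero + (f (suc i) + ∑ n (g ∘ suc))  ≡⟨ x∙yz≈y∙xz (g zero) (f (suc i)) _ ⟩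
  f (suc i) + (g zero + ∑ n (g ∘ suc))  ∎
  where open ≡-Reasoning

∑-update₂ : ∀ n (f g : Fin n → ℕ) {i j} → i ≢ j → (∀ x → x ≢ i → x ≢ j → f x ≡ g x) →
            g i + g j + ∑ n f ≡ f i + f j + ∑ n g
∑-update₂ n f g {i} {j} i≢j f≗g = begin
  g i + g j + ∑ n f    ≡⟨ xy∙z≈y∙xz (g i) (g j) (∑ n f) ⟩
  g j + (g i + ∑ n f)  ≡⟨ cong (λ t → g j + (t + ∑ n f)) (updateAt-updates i f) ⟨
  g j + (h i + ∑ n f)  ≡⟨ cong (_+_ (g j)) (∑-update n f h i f≗h) ⟩
  g j + (f i + ∑ n h)  ≡⟨ x∙yz≈y∙xz (g j) (f i) (∑ n h) ⟩
  f i + (g j + ∑ n h)  ≡⟨ cong (_+_ (f i)) (∑-update n h g j h≗g) ⟩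
  f i + (h j + ∑ n g)  ≡⟨ cong (λ t → f i + (t + ∑ n g)) (updateAt-minimal j i f (i≢j ∘ sym)) ⟩
  f i + (f j + ∑ n g)  ≡⟨ ℕP.+-assoc (f i) (f j) (∑ n g) ⟨
  f i + f j + ∑ n g    ∎
  where
  open ≡-Reasoning
  h : Fin n → ℕ
  h = updateAt f i (λ _ → g i)
  f≗h : ∀ x → x ≢ i → f x ≡ h x
  f≗h x x≢i = sym (updateAt-minimal x i f x≢i)
  h≗g : ∀ x → x ≢ j → h x ≡ g x
  h≗g x x≢j with x FinP.≟ i
  ... | yes refl = updateAt-updates i f
  ... | no x≢i   = trans (updateAt-minimal x i f x≢i) (f≗g x x≢i x≢j)

o+m≡p+n∧p<o⇒m<n : ∀ {m n o p} → o + m ≡ p + n → p < o → m < n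
o+m≡p+n∧p<o⇒m<n o+m≡p+n p<o = ℕP.≰⇒> λ n≤m → ℕP.<-irrefl (sym o+m≡p+n) (ℕP.+-mono-<-≤ p<o n≤m)

square-transfer-< : ∀ {x y} → y < x → x * x + suc y * suc y < suc x * suc x + y * y
square-transfer-< {x} {y} y<x = subst₂ _<_ (sym (expandʳ x y)) (sym (expandˡ x y))
  (ℕP.+-monoʳ-< (x * x + y * y) (ℕ.s<s (ℕP.+-mono-< y<x y<x)))
  where
  expandʳ : ∀ a b → a * a + suc b * suc b ≡ a * a + b * b + suc (b + b)
  expandʳ = solve-∀
  expandˡ : ∀ a b → suc a * suc a + b * b ≡ a * a + b * b + suc (a + a)
  expandˡ = solve-∀

∑-squares-transfer : ∀ n (d d′ : Fin n → ℕ) {i j} → i ≢ j → (∀ x → x ≢ i → x ≢ j → d′ x ≡ d x) →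
                     d i ≡ suc (d′ i) → d′ j ≡ suc (d j) → d j < d′ i →
                     ∑ n (λ x → d′ x * d′ x) < ∑ n (λ x → d x * d x)
∑-squares-transfer n d d′ {i} {j} i≢j d′≗d di dj′ dj<d′i =
  o+m≡p+n∧p<o⇒m<n moved (square-transfer-< dj<d′i)
  where
  sq sq′ : Fin n → ℕ
  sq x = d x * d x
  sq′ x = d′ x * d′ x
  moved : suc (d′ i) * suc (d′ i) + d j * d j + ∑ n sq′ ≡ d′ i * d′ i + suc (d j) * suc (d j) + ∑ n sq
  moved = subst₂ (λ a b → a * a + d j * d j + ∑ n sq′ ≡ d′ i * d′ i + b * b + ∑ n sq) di dj′
            (∑-update₂ n sq′ sq i≢j λ x x≢i x≢j → cong (λ t → t * t) (d′≗d x x≢i x≢j))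

∑⊎ : ∀ m n → (Fin m ⊎ Fin n → ℕ) → ℕ
∑⊎ m n f = ∑ m (f ∘ inj₁) + ∑ n (f ∘ inj₂)

∑⊎-cong : ∀ m n {f g : Fin m ⊎ Fin n → ℕ} → (∀ x → f x ≡ g x) → ∑⊎ m n f ≡ ∑⊎ m n g
∑⊎-cong m n f≗g = cong₂ _+_ (∑-cong m (f≗g ∘ inj₁)) (∑-cong n (f≗g ∘ inj₂))

∑⊎-update : ∀ m n (f g : Fin m ⊎ Fin n → ℕ) x → (∀ y → y ≢ x → f y ≡ g y) →
            g x + ∑⊎ m n f ≡ f x + ∑⊎ m n g
∑⊎-update m n f g (inj₁ i) f≗g = begin
  g (inj₁ i) + (∑ m (f ∘ inj₁) + ∑ n (f ∘ inj₂))  ≡⟨ ℕP.+-assoc (g (inj₁ i)) _ _ ⟨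
  g (inj₁ i) + ∑ m (f ∘ inj₁) + ∑ n (f ∘ inj₂)
    ≡⟨ cong₂ _+_ (∑-update m _ _ i λ j j≢i → f≗g (inj₁ j) (j≢i ∘ inj₁-injective))
                 (∑-cong n λ j → f≗g (inj₂ j) λ ()) ⟩
  f (inj₁ i) + ∑ m (g ∘ inj₁) + ∑ n (g ∘ inj₂)    ≡⟨ ℕP.+-assoc (f (inj₁ i)) _ _ ⟩
  f (inj₁ i) + (∑ m (g ∘ inj₁) + ∑ n (g ∘ inj₂))  ∎
  where open ≡-Reasoning
∑⊎-update m n f g (inj₂ i) f≗g = begin
  g (inj₂ i) + (∑ m (f ∘ inj₁) + ∑ n (f ∘ inj₂))  ≡⟨ x∙yz≈y∙xz (g (inj₂ i)) (∑ m (f ∘ inj₁)) (∑ n (f ∘ inj₂)) ⟩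
  ∑ m (f ∘ inj₁) + (g (inj₂ i) + ∑ n (f ∘ inj₂))
    ≡⟨ cong₂ _+_ (∑-cong m λ j → f≗g (inj₁ j) λ ())
                 (∑-update n _ _ i λ j j≢i → f≗g (inj₂ j) (j≢i ∘ inj₂-injective)) ⟩
  ∑ m (g ∘ inj₁) + (f (inj₂ i) + ∑ n (g ∘ inj₂))  ≡⟨ x∙yz≈y∙xz (∑ m (g ∘ inj₁)) (f (inj₂ i)) (∑ n (g ∘ inj₂)) ⟩
  f (inj₂ i) + (∑ m (g ∘ inj₁) + ∑ n (g ∘ inj₂))  ∎
  where open ≡-Reasoning

∑⊎-comm : ∀ m n k l (M : Fin m ⊎ Fin n → Fin k ⊎ Fin l → ℕ) →
          ∑⊎ m n (λ x → ∑⊎ k l (M x)) ≡ ∑⊎ k l (λ y → ∑⊎ m n (λ x → M x y))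
∑⊎-comm m n k l M = begin
  ∑⊎ m n (λ x → ∑⊎ k l (M x))          ≡⟨ cong₂ _+_ (∑-distrib-+ m _ _) (∑-distrib-+ n _ _) ⟩
  (r₁₁ + r₁₂) + (r₂₁ + r₂₂)            ≡⟨ interchange r₁₁ r₁₂ r₂₁ r₂₂ ⟩
  (r₁₁ + r₂₁) + (r₁₂ + r₂₂)            ≡⟨ cong₂ _+_ (cong₂ _+_ (∑-comm m k M₁₁) (∑-comm n k M₂₁))
                                                    (cong₂ _+_ (∑-comm m l M₁₂) (∑-comm n l M₂₂)) ⟩
  (c₁₁ + c₂₁) + (c₁₂ + c₂₂)            ≡⟨ cong₂ _+_ (∑-distrib-+ k _ _) (∑-distrib-+ l _ _) ⟨
  ∑⊎ k l (λ y → ∑⊎ m n (λ x → M x y))  ∎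
  where
  open ≡-Reasoning
  M₁₁ : Fin m → Fin k → ℕ
  M₁₁ i j = M (inj₁ i) (inj₁ j)
  M₁₂ : Fin m → Fin l → ℕ
  M₁₂ i j = M (inj₁ i) (inj₂ j)
  M₂₁ : Fin n → Fin k → ℕ
  M₂₁ i j = M (inj₂ i) (inj₁ j)
  M₂₂ : Fin n → Fin l → ℕ
  M₂₂ i j = M (inj₂ i) (inj₂ j)
  r₁₁ r₁₂ r₂₁ r₂₂ c₁₁ c₁₂ c₂₁ c₂₂ : ℕ
  r₁₁ = ∑ m (λ i → ∑ k (M₁₁ i))
  r₁₂ = ∑ m (λ i → ∑ l (M₁₂ i))
  r₂₁ = ∑ n (λ i → ∑ k (M₂₁ i))
  r₂₂ = ∑ n (λ i → ∑ l (M₂₂ i))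
  c₁₁ = ∑ k (λ j → ∑ m (λ i → M₁₁ i j))
  c₁₂ = ∑ l (λ j → ∑ m (λ i → M₁₂ i j))
  c₂₁ = ∑ k (λ j → ∑ n (λ i → M₂₁ i j))
  c₂₂ = ∑ l (λ j → ∑ n (λ i → M₂₂ i j))

∑⊎-<⇒∃< : ∀ m n {f g : Fin m ⊎ Fin n → ℕ} → ∑⊎ m n f < ∑⊎ m n g → ∃ λ x → f x < g x
∑⊎-<⇒∃< m n {f} {g} Σf<Σg
  with FinP.any? (λ i → f (inj₁ i) ℕP.<? g (inj₁ i)) | FinP.any? (λ j → f (inj₂ j) ℕP.<? g (inj₂ j))
... | yes (i , fi<gi) | _               = inj₁ i , fi<gi
... | no _            | yes (j , fj<gj) = inj₂ j , fj<gj
... | no ¬f₁<g₁       | no ¬f₂<g₂       = contradiction Σf<Σg (ℕP.≤⇒≯ (ℕP.+-mono-≤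
  (∑-mono-≤ m λ i → ℕP.≮⇒≥ λ fi<gi → ¬f₁<g₁ (i , fi<gi))
  (∑-mono-≤ n λ j → ℕP.≮⇒≥ λ fj<gj → ¬f₂<g₂ (j , fj<gj))))

b2n-< : ∀ {x y} → b2n x < b2n y → x ≡ false × y ≡ true
b2n-< {false} {true}  _         = refl , refl
b2n-< {false} {false} ()
b2n-< {true}  {false} ()
b2n-< {true}  {true}  (ℕ.s≤s ())

i<suc[j]⇒i≤j : ∀ {i j} → i ℤ.< ℤ.suc j → i ℤ.≤ j
i<suc[j]⇒i≤j {i} {j} i<j+1 =
  subst₂ ℤ._≤_ (ℤP.pred-suc i) (ℤP.pred-suc j) (ℤP.pred-mono (ℤP.i<j⇒suc[i]≤j i<j+1))

/ℕ-unique : ∀ x d z .{{_ : ℕ.NonZero d}} →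
            z ℤ.* + d ℤ.≤ x → x ℤ.< ℤ.suc z ℤ.* + d → x ℤ./ℕ d ≡ z
/ℕ-unique x d z lo hi = ℤP.≤-antisym
  (i<suc[j]⇒i≤j (ℤP.*-cancelʳ-<-nonNeg (+ d) (ℤP.≤-<-trans ([n/ℕd]*d≤n x d) hi)))
  (i<suc[j]⇒i≤j (ℤP.*-cancelʳ-<-nonNeg (+ d) (ℤP.≤-<-trans lo (n<s[n/ℕd]*d x d))))

floor-unique : ∀ (p : ℚ) (z : ℤ) → z ℤ.* ↧ p ℤ.≤ ↥ p → ↥ p ℤ.< ℤ.suc z ℤ.* ↧ p → floor p ≡ z
floor-unique (mkℚ n d _) z lo hi = trans (ℤP.*-identityˡ _) (/ℕ-unique n (suc d) z lo hi)

ceiling-unique : ∀ (p : ℚ) (z : ℤ) → ℤ.pred z ℤ.* ↧ p ℤ.< ↥ p → ↥ p ℤ.≤ z ℤ.* ↧ p → ceiling p ≡ z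
ceiling-unique p@(mkℚ _ _ _) z lo hi =
  trans (cong ℤ.-_ (floor-unique (ℚ.- p) (ℤ.- z) lo′ hi′)) (ℤP.neg-involutive z)
  where
  lo′ : ℤ.- z ℤ.* ↧ (ℚ.- p) ℤ.≤ ↥ (ℚ.- p)
  lo′ = subst₂ ℤ._≤_ (trans (ℤP.neg-distribˡ-* z (↧ p)) (cong (ℤ.- z ℤ.*_) (sym (↧-neg p))))
                     (sym (↥-neg p)) (ℤP.neg-mono-≤ hi)
  hi′ : ↥ (ℚ.- p) ℤ.< ℤ.suc (ℤ.- z) ℤ.* ↧ (ℚ.- p)
  hi′ = subst₂ ℤ._<_ (sym (↥-neg p))
          (trans (ℤP.neg-distribˡ-* (ℤ.pred z) (↧ p))
                 (cong₂ ℤ._*_ (ℤP.neg-distrib-+ ℤ.-1ℤ z) (sym (↧-neg p))))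
          (ℤP.neg-mono-< lo)

-- Here suc k is gcd S n.
/-scaled : ∀ S n .{{_ : ℕ.NonZero n}} → Σ ℕ λ k →
           + S ≡ ↥ (+ S / n) ℤ.* + suc k ×
           (∀ m → + (m * n) ≡ + m ℤ.* ↧ (+ S / n) ℤ.* + suc k)
/-scaled S n = scaledBy (gcd S n) (gcd[m,n]≢0 S n (inj₂ (ℕ.≢-nonZero⁻¹ n))) (↥-/ (+ S) n) (↧-/ (+ S) n)
  where
  p : ℚ
  p = + S / n
  scaledBy : ∀ g → g ≢ 0 → ↥ p ℤ.* + g ≡ + S → ↧ p ℤ.* + g ≡ + n → Σ ℕ λ k →
             + S ≡ ↥ p ℤ.* + suc k × (∀ m → + (m * n) ≡ + m ℤ.* ↧ p ℤ.* + suc k)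
  scaledBy zero    g≢0 _  _  = contradiction refl g≢0
  scaledBy (suc k) _   ↥g ↧g = k , sym ↥g , λ m → begin
    + (m * n)                  ≡⟨ ℤP.pos-* m n ⟩
    + m ℤ.* + n                ≡⟨ cong (+ m ℤ.*_) ↧g ⟨
    + m ℤ.* (↧ p ℤ.* + suc k)  ≡⟨ ℤP.*-assoc (+ m) (↧ p) (+ suc k) ⟨
    + m ℤ.* ↧ p ℤ.* + suc k    ∎
    where open ≡-Reasoning

floor-/ : ∀ S n v .{{_ : ℕ.NonZero n}} → v * n ≤ S → S < suc v * n → floor (+ S / n) ≡ + v
floor-/ S n v lo hi with /-scaled S n
... | k , S≡ , m*n≡ = floor-unique (+ S / n) (+ v)
  (ℤP.*-cancelʳ-≤-pos _ _ (+ suc k) (subst₂ ℤ._≤_ (m*n≡ v) S≡ (ℤ.+≤+ lo)))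
  (ℤP.*-cancelʳ-<-nonNeg (+ suc k) (subst₂ ℤ._<_ S≡ (m*n≡ (suc v)) (ℤ.+<+ hi)))

ceiling-/ : ∀ S n w .{{_ : ℕ.NonZero n}} → w * n < S → S ≤ suc w * n → ceiling (+ S / n) ≡ + suc w
ceiling-/ S n w lo hi with /-scaled S n
... | k , S≡ , m*n≡ = ceiling-unique (+ S / n) (+ suc w)
  (ℤP.*-cancelʳ-<-nonNeg (+ suc k) (subst₂ ℤ._<_ (m*n≡ w) S≡ (ℤ.+<+ lo)))
  (ℤP.*-cancelʳ-≤-pos _ _ (+ suc k) (subst₂ ℤ._≤_ S≡ (m*n≡ (suc w)) (ℤ.+≤+ hi)))

NearlyConstant : ∀ {n} → (Fin n → ℕ) → Set
NearlyConstant d = ∀ i j → d i ≤ suc (d j)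

nearlyConstant⊎gap : ∀ {n} (d : Fin n → ℕ) → NearlyConstant d ⊎ ∃₂ λ i j → suc (d j) < d i
nearlyConstant⊎gap d with FinP.any? (λ i → FinP.any? (λ j → suc (d j) ℕP.<? d i))
... | yes (i , j , gap) = inj₂ (i , j , gap)
... | no noGap          = inj₁ λ i j → ℕP.≮⇒≥ λ gap → noGap (i , j , gap)

-- Every d y lies within one of d x, so d x is ⌊S/n⌋ when d x · n ≤ S and ⌈S/n⌉ otherwise.
nearlyEqual : ∀ n {num : ℤ} (d : Fin n → ℕ) → num ≡ + ∑ n d → NearlyConstant d → NearlyEqual n num d
nearlyEqual zero    d _    _      = _
nearlyEqual (suc n) d refl spread x with d x * suc n ℕP.≤? ∑ (suc n) d
... | yes lo = inj₁ (sym (floor-/ (∑ (suc n) d) (suc n) (d x) lo below))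
  where
  below : ∑ (suc n) d < suc (d x) * suc n
  below = subst (∑ (suc n) d <_) (∑-const (suc n) (suc (d x)))
                (∑-mono-< (suc n) (λ y → spread y x) x (ℕP.n<1+n (d x)))
... | no ¬lo = inj₂ (sym (ceiling-branch (d x) refl (ℕP.≰⇒> ¬lo)))
  where
  ceiling-branch : ∀ m → d x ≡ m → ∑ (suc n) d < m * suc n → ceiling (+ ∑ (suc n) d / suc n) ≡ + m
  ceiling-branch zero    _      ()
  ceiling-branch (suc w) dx≡1+w hi = ceiling-/ (∑ (suc n) d) (suc n) w above (ℕP.<⇒≤ hi)
    where
    above : w * suc n < ∑ (suc n) d
    above = subst (_< ∑ (suc n) d) (∑-const (suc n) w)
      (∑-mono-< (suc n) (λ y → ℕP.≤-pred (subst (_≤ suc (d y)) dx≡1+w (spread x y)))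
                x (ℕP.≤-reflexive (sym dx≡1+w)))

_≟⊎_ : ∀ {m n} → DecidableEquality (Fin m ⊎ Fin n)
_≟⊎_ = ≡-dec FinP._≟_ FinP._≟_

transpose : ∀ {nA nB nH nK} → BipGraph nA nB nH nK → BipGraph nH nK nA nB
transpose G v u = G u v

handshake : ∀ {nA nB nH nK} (G : BipGraph nA nB nH nK) → edges G ≡ ∑⊎ nH nK (degV G)
handshake {nA} {nB} {nH} {nK} G = ∑⊎-comm nA nB nH nK (λ u v → b2n (G u v))

module _ {nA nB nH nK : ℕ} where

  Graph : Set
  Graph = BipGraph nA nB nH nK

  edges-cong-degU : ∀ {G G′ : Graph} → (∀ u → degU G′ u ≡ degU G u) → edges G′ ≡ edges G
  edges-cong-degU = ∑⊎-cong nA nB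

  edges-cong-degV : ∀ {G G′ : Graph} → (∀ v → degV G′ v ≡ degV G v) → edges G′ ≡ edges G
  edges-cong-degV {G} {G′} same = trans (handshake G′) (trans (∑⊎-cong nH nK same) (sym (handshake G)))

  setEdge : Graph → U nA nB → V nH nK → Bool → Graph
  setEdge G u v x u′ v′ = if does (u′ ≟⊎ u) ∧ does (v′ ≟⊎ v) then x else G u′ v′

  module _ (G : Graph) (u : U nA nB) (v : V nH nK) (x : Bool) where

    setEdge-≡ : setEdge G u v x u v ≡ x
    setEdge-≡ with u ≟⊎ u | v ≟⊎ v
    ... | yes _   | yes _   = refl
    ... | no u≢u  | _       = contradiction refl u≢u
    ... | yes _   | no v≢v  = contradiction refl v≢v

    setEdge-row≢ : ∀ {u′} v′ → u′ ≢ u → setEdge G u v x u′ v′ ≡ G u′ v′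
    setEdge-row≢ {u′} v′ u′≢u with u′ ≟⊎ u
    ... | yes u′≡u = contradiction u′≡u u′≢u
    ... | no _     = refl

    setEdge-col≢ : ∀ u′ {v′} → v′ ≢ v → setEdge G u v x u′ v′ ≡ G u′ v′
    setEdge-col≢ u′ {v′} v′≢v with u′ ≟⊎ u | v′ ≟⊎ v
    ... | _     | yes v′≡v = contradiction v′≡v v′≢v
    ... | yes _ | no _     = refl
    ... | no _  | no _     = refl

    degU-setEdge : b2n (G u v) + degU (setEdge G u v x) u ≡ b2n x + degU G u
    degU-setEdge = trans (∑⊎-update nH nK _ _ v λ v′ v′≢v → cong b2n (setEdge-col≢ u v′≢v))
                         (cong (λ y → b2n y + degU G u) setEdge-≡)

    degV-setEdge : b2n (G u v) + degV (setEdge G u v x) v ≡ b2n x + degV G v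
    degV-setEdge = trans (∑⊎-update nA nB _ _ u λ u′ u′≢u → cong b2n (setEdge-row≢ v u′≢u))
                         (cong (λ y → b2n y + degV G v) setEdge-≡)

    degU-setEdge-≢ : ∀ {u′} → u′ ≢ u → degU (setEdge G u v x) u′ ≡ degU G u′
    degU-setEdge-≢ u′≢u = ∑⊎-cong nH nK λ v′ → cong b2n (setEdge-row≢ v′ u′≢u)

    degV-setEdge-≢ : ∀ {v′} → v′ ≢ v → degV (setEdge G u v x) v′ ≡ degV G v′
    degV-setEdge-≢ v′≢v = ∑⊎-cong nA nB λ u′ → cong b2n (setEdge-col≢ u′ v′≢v)

  moveEdge : Graph → U nA nB → U nA nB → V nH nK → Graph
  moveEdge G u u′ v = setEdge (setEdge G u v false) u′ v true

  module _ (G : Graph) {u u′ : U nA nB} {v : V nH nK}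
           (u′≢u : u′ ≢ u) (uv : G u v ≡ true) (u′v : G u′ v ≡ false) where

    private
      G₁ : Graph
      G₁ = setEdge G u v false

      u′v₁ : G₁ u′ v ≡ false
      u′v₁ = trans (setEdge-row≢ G u v false v u′≢u) u′v

    degU-moveEdge-source : degU G u ≡ suc (degU (moveEdge G u u′ v) u)
    degU-moveEdge-source = trans
      (sym (subst (λ y → b2n y + degU G₁ u ≡ degU G u) uv (degU-setEdge G u v false)))
      (cong suc (sym (degU-setEdge-≢ G₁ u′ v true (u′≢u ∘ sym))))

    degU-moveEdge-target : degU (moveEdge G u u′ v) u′ ≡ suc (degU G u′)
    degU-moveEdge-target = trans
      (subst (λ y → b2n y + degU (moveEdge G u u′ v) u′ ≡ suc (degU G₁ u′)) u′v₁ (degU-setEdge G₁ u′ v true))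
      (cong suc (degU-setEdge-≢ G u v false u′≢u))

    degU-moveEdge-≢ : ∀ {w} → w ≢ u → w ≢ u′ → degU (moveEdge G u u′ v) w ≡ degU G w
    degU-moveEdge-≢ w≢u w≢u′ = trans (degU-setEdge-≢ G₁ u′ v true w≢u′) (degU-setEdge-≢ G u v false w≢u)

    degV-moveEdge-≡ : degV (moveEdge G u u′ v) v ≡ degV G v
    degV-moveEdge-≡ = trans
      (subst (λ y → b2n y + degV (moveEdge G u u′ v) v ≡ suc (degV G₁ v)) u′v₁ (degV-setEdge G₁ u′ v true))
      (subst (λ y → b2n y + degV G₁ v ≡ degV G v) uv (degV-setEdge G u v false))

    degV-moveEdge : ∀ w → degV (moveEdge G u u′ v) w ≡ degV G w
    degV-moveEdge w = byCases (w ≟⊎ v)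
      where
      byCases : Dec (w ≡ v) → degV (moveEdge G u u′ v) w ≡ degV G w
      byCases (yes refl) = degV-moveEdge-≡
      byCases (no w≢v)   = trans (degV-setEdge-≢ G₁ u′ v true w≢v) (degV-setEdge-≢ G u v false w≢v)

  degB : Graph → Fin nB → ℕ
  degB G b = degU G (inj₂ b)

  SameDegreesOnAV : Graph → Graph → Set
  SameDegreesOnAV G G′ = (∀ a → degU G′ (inj₁ a) ≡ degU G (inj₁ a)) × (∀ v → degV G′ v ≡ degV G v)

  exclusiveNeighbour : (G : Graph) {u u′ : U nA nB} → degU G u′ < degU G u →
                       ∃ λ v → G u v ≡ true × G u′ v ≡ false
  exclusiveNeighbour G {u} {u′} lt with ∑⊎-<⇒∃< nH nK {b2n ∘ G u′} {b2n ∘ G u} lt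
  ... | v , b2n<b2n with b2n-< b2n<b2n
  ...   | u′v , uv = v , uv , u′v

  potential : Graph → ℕ
  potential G = ∑ nB (λ b → degB G b * degB G b)

  balancingMove : (G : Graph) {b b′ : Fin nB} → suc (degB G b′) < degB G b →
                  Σ Graph λ G′ → SameDegreesOnAV G G′ × potential G′ < potential G
  balancingMove G {b} {b′} gap with exclusiveNeighbour G {inj₂ b} {inj₂ b′} (ℕP.<-trans (ℕP.n<1+n _) gap)
  ... | v , bv , b′v = G′ , (sameA , degV-moveEdge G b′≢b bv b′v) , smaller
    where
    G′ : Graph
    G′ = moveEdge G (inj₂ b) (inj₂ b′) v
    b≢b′ : b ≢ b′
    b≢b′ refl = ℕP.n≮n _ (ℕP.<-trans (ℕP.n<1+n _) gap)
    b′≢b : inj₂ b′ ≢ inj₂ b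
    b′≢b = b≢b′ ∘ sym ∘ inj₂-injective
    sameA : ∀ a → degU G′ (inj₁ a) ≡ degU G (inj₁ a)
    sameA a = degU-moveEdge-≢ G b′≢b bv b′v (λ ()) (λ ())
    source : degB G b ≡ suc (degB G′ b)
    source = degU-moveEdge-source G b′≢b bv b′v
    smaller : potential G′ < potential G
    smaller = ∑-squares-transfer nB (degB G) (degB G′) b≢b′
      (λ c c≢b c≢b′ → degU-moveEdge-≢ G b′≢b bv b′v (c≢b ∘ inj₂-injective) (c≢b′ ∘ inj₂-injective))
      source (degU-moveEdge-target G b′≢b bv b′v) (ℕ.s<s⁻¹ (subst (suc (degB G b′) <_) source gap))

  balanceB : (G : Graph) → Σ Graph λ G′ → SameDegreesOnAV G G′ × NearlyConstant (degB G′)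
  balanceB G = go G (<-wellFounded (potential G))
    where
    go : (G : Graph) → Acc _<_ (potential G) → Σ Graph λ G′ → SameDegreesOnAV G G′ × NearlyConstant (degB G′)
    go G (acc rec) with nearlyConstant⊎gap (degB G)
    ... | inj₁ balanced = G , ((λ _ → refl) , (λ _ → refl)) , balanced
    ... | inj₂ (_ , _ , gap) with balancingMove G gap
    ...   | G′ , (sameA , sameV) , smaller with go G′ (rec smaller)
    ...     | G″ , (sameA′ , sameV′) , balanced =
              G″ , ((λ a → trans (sameA′ a) (sameA a)) , (λ v → trans (sameV′ v) (sameV v))) , balanced

balanceK : ∀ {nA nB nH nK} (G : BipGraph nA nB nH nK) → Σ (BipGraph nA nB nH nK) λ G′ →
           (∀ h → degV G′ (inj₁ h) ≡ degV G (inj₁ h)) × (∀ u → degU G′ u ≡ degU G u) ×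
           NearlyConstant (λ k → degV G′ (inj₂ k))
balanceK G with balanceB (transpose G)
... | Gᵀ , (sameH , sameU) , balanced = transpose Gᵀ , sameH , sameU , balanced

∑ℤ-cong : ∀ n {f g : Fin n → ℤ} → (∀ i → f i ≡ g i) → ∑ℤ n f ≡ ∑ℤ n g
∑ℤ-cong zero    f≗g = refl
∑ℤ-cong (suc n) f≗g = cong₂ ℤ._+_ (f≗g zero) (∑ℤ-cong n (f≗g ∘ suc))

∑ℤ-+ : ∀ n (f : Fin n → ℕ) → ∑ℤ n (λ i → + f i) ≡ + ∑ n f
∑ℤ-+ zero    f = refl
∑ℤ-+ (suc n) f =
  trans (cong (ℤ._+_ (+ f zero)) (∑ℤ-+ n (f ∘ suc))) (sym (ℤP.pos-+ (f zero) (∑ n (f ∘ suc))))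

+[m+n]-+m≡+n : ∀ m n → + (m + n) ℤ.- + m ≡ + n
+[m+n]-+m≡+n m n =
  trans (ℤP.m-n≡m⊖n (m + n) m) (trans (ℤP.⊖-≥ (ℕP.m≤m+n m n)) (cong +_ (ℕP.m+n∸m≡n m n)))

residual : ∀ m n (f : Fin m → ℕ) (g : Fin n → ℕ) (p : Fin m → ℤ) → (∀ i → + f i ≡ p i) →
           + (∑ m f + ∑ n g) ℤ.- ∑ℤ m p ≡ + ∑ n g
residual m n f g p f≡p =
  trans (cong (λ s → + (∑ m f + ∑ n g) ℤ.- s) (trans (∑ℤ-cong m (sym ∘ f≡p)) (∑ℤ-+ m f)))
        (+[m+n]-+m≡+n (∑ m f) (∑ n g))

module _ {nA nB nH nK : ℕ} {p : Fin nA → ℤ} {q : Fin nH → ℤ} {ε : ℕ} where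

  realization-transfer : ∀ {G G′ : BipGraph nA nB nH nK} → edges G′ ≡ edges G →
                         (∀ a → degU G′ (inj₁ a) ≡ degU G (inj₁ a)) →
                         (∀ h → degV G′ (inj₁ h) ≡ degV G (inj₁ h)) →
                         IsRealization p q ε G → IsRealization p q ε G′
  realization-transfer sameE sameA sameH (edges≡ε , degA≡p , degH≡q) =
    trans sameE edges≡ε ,
    (λ a → trans (cong +_ (sameA a)) (degA≡p a)) ,
    (λ h → trans (cong +_ (sameH h)) (degH≡q h))

  residualB : ∀ {G : BipGraph nA nB nH nK} → IsRealization p q ε G → + ε ℤ.- ∑ℤ nA p ≡ + ∑ nB (degB G)
  residualB (edges≡ε , degA≡p , _) =
    subst (λ e → + e ℤ.- ∑ℤ nA p ≡ _) edges≡ε (residual nA nB _ _ p degA≡p)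

  residualK : ∀ {G : BipGraph nA nB nH nK} → IsRealization p q ε G →
              + ε ℤ.- ∑ℤ nH q ≡ + ∑ nK (λ k → degV G (inj₂ k))
  residualK {G} (edges≡ε , _ , degH≡q) =
    subst (λ e → + e ℤ.- ∑ℤ nH q ≡ _) (trans (sym (handshake G)) edges≡ε) (residual nH nK _ _ q degH≡q)

theorem2 : (nA nB nH nK : ℕ) → nA + nB ≥ 1 → nH + nK ≥ 1 →
           (p : Fin nA → ℤ) (q : Fin nH → ℤ) (ε : ℕ) →
           (Graphical nA nB nH nK p q ε → HasBalancedRealization nA nB nH nK p q ε) ×
           (HasBalancedRealization nA nB nH nK p q ε → Graphical nA nB nH nK p q ε)
theorem2 nA nB nH nK _ _ p q ε = balance , λ (G , real , _) → G , real
  where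
  balance : Graphical nA nB nH nK p q ε → HasBalancedRealization nA nB nH nK p q ε
  balance (G , real) with balanceB G
  ... | G₁ , (sameA₁ , sameV₁) , balancedB₁ with balanceK G₁
  ... | G₂ , sameH₂ , sameU₂ , balancedK₂ =
        G₂ , real₂ , nearlyEqual nB (degB G₂) (residualB {G = G₂} real₂) balancedB₂ ,
        nearlyEqual nK (λ k → degV G₂ (inj₂ k)) (residualK {G = G₂} real₂) balancedK₂
    where
    real₁ : IsRealization p q ε G₁
    real₁ = realization-transfer {G = G} {G₁} (edges-cong-degV {G = G} {G₁} sameV₁) sameA₁ (sameV₁ ∘ inj₁)
                                 real
    real₂ : IsRealization p q ε G₂
    real₂ = realization-transfer {G = G₁} {G₂} (edges-cong-degU {G = G₁} {G₂} sameU₂) (sameU₂ ∘ inj₁) sameH₂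
                                 real₁
    balancedB₂ : NearlyConstant (degB G₂)
    balancedB₂ b b′ =
      subst₂ (λ x y → x ≤ suc y) (sym (sameU₂ (inj₂ b))) (sym (sameU₂ (inj₂ b′))) (balancedB₁ b b′)
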